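{- For $h\ge 1$, let $\Gamma_h$ be the 1-2 drawing of the complete ternary tree $T_h$ constructed by using Construction 1 only, i.e., $\Gamma_1$ is a single node at a grid point, and for $h\ge 2$, $\Gamma_h$ is obtained by Construction 1 with $\Gamma^a,\Gamma^b,\Gamma^c$ all being copies of $\Gamma_{h-1}$. Then $\Gamma_h$ has width $2^h-1$ and height $2^{h-1}$.
   Context: $T_h$ denotes the complete ternary tree: every non-leaf node has exactly three children and every root-to-leaf path has exactly $h$ nodes. A drawing means a planar straight-line orthogonal grid drawing: nodes at distinct integer points, each edge a horizontal or vertical segment, no crossings. The width (height) of a drawing is the number of vertical (horizontal) grid lines intersecting it. Construction 1: given three drawings $\Gamma^a,\Gamma^b,\Gamma^c$ of $T_{h-1}$, place the root $r$ of $T_h$ at a grid point; translate $\Gamma^a$ so that its topmost intersected grid row is one unit below $r$ and its root lies on the vertical line through $r$; rotate $\Gamma^b$ clockwise by $90^\circ$ and translate it so that its rightmost intersected grid column is one unit to the left of the leftmost column intersecting $\Gamma^a$ and its root lies on the horizontal line through $r$; rotate $\Gamma^c$ counterclockwise by $90^\circ$ and translate it so that its leftmost intersected column is one unit to the right of the rightmost column intersecting $\Gamma^a$ and its root lies on the horizontal line through $r$; connect $r$ to the three roots. -}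

module Defs where

open import Data.Nat using (ℕ; zero; suc)
open import Data.Integer using (ℤ; +_; -_; _+_; _-_; _⊓_; _⊔_)
open import Data.Product using (_×_; _,_; proj₁; proj₂)
open import Data.List using (List; []; _∷_; _++_; map; foldr)

-- A grid point (x , y); x grows to the right, y grows upwards.
Point : Set
Point = ℤ × ℤ

-- A straight-line grid drawing of a rooted tree: the position of the root,
-- the positions of all nodes (root included), and the edges as pairs of
-- endpoint positions (each edge is the segment between its endpoints).
record Drawing : Set where
  constructor drawing
  field
    root  : Point
    nodes : List Point
    edges : List (Point × Point)
open Drawing public

translateP : ℤ → ℤ → Point → Point
translateP dx dy (x , y) = (x + dx , y + dy)

rotCWP : Point → Point
rotCWP (x , y) = (y , - x)

rotCCWP : Point → Point
rotCCWP (x , y) = (- y , x)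

mapD : (Point → Point) → Drawing → Drawing
mapD f (drawing r ns es) =
  drawing (f r) (map f ns) (map (λ e → (f (proj₁ e) , f (proj₂ e))) es)

translate : ℤ → ℤ → Drawing → Drawing
translate dx dy = mapD (translateP dx dy)

rotCW rotCCW : Drawing → Drawing
rotCW  = mapD rotCWP
rotCCW = mapD rotCCWP

-- Every edge is a segment
-- between two nodes, so the extreme coordinates are attained at nodes
-- (the root is used as the starting value of the folds).
minX maxX minY maxY : Drawing → ℤ
minX Γ = foldr _⊓_ (proj₁ (root Γ)) (map proj₁ (nodes Γ))
maxX Γ = foldr _⊔_ (proj₁ (root Γ)) (map proj₁ (nodes Γ))
minY Γ = foldr _⊓_ (proj₂ (root Γ)) (map proj₂ (nodes Γ))
maxY Γ = foldr _⊔_ (proj₂ (root Γ)) (map proj₂ (nodes Γ))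

-- width = number of vertical grid lines intersecting the drawing,
-- height = number of horizontal grid lines intersecting the drawing.
width height : Drawing → ℤ
width  Γ = maxX Γ - minX Γ + + 1
height Γ = maxY Γ - minY Γ + + 1

construction1 : Drawing → Drawing → Drawing → Drawing
construction1 Γa Γb Γc =
  drawing r (r ∷ nodes A ++ nodes B ++ nodes C)
            ((r , root A) ∷ (r , root B) ∷ (r , root C) ∷ edges A ++ edges B ++ edges C)
  where
  r : Point
  r = (+ 0 , + 0)
  -- topmost row of A one unit below r, root of A on the vertical line of r
  A : Drawing
  A = translate (- proj₁ (root Γa)) (- + 1 - maxY Γa) Γa
  -- Γb rotated clockwise; rightmost column one unit left of A's leftmost,
  -- root on the horizontal line of r
  B' : Drawing
  B' = rotCW Γb
  B : Drawing
  B = translate ((minX A - + 1) - maxX B') (- proj₂ (root B')) B'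
  -- Γc rotated counterclockwise; leftmost column one unit right of A's
  -- rightmost, root on the horizontal line of r
  C' : Drawing
  C' = rotCCW Γc
  C : Drawing
  C = translate ((maxX A + + 1) - minX C') (- proj₂ (root C')) C'

-- Γ h for h ≥ 1 (the value at h = 0 is an irrelevant dummy, T_0 is undefined):
-- Γ 1 is a single node, Γ h = Construction 1 applied to three copies of Γ (h-1).
single : Drawing
single = drawing (+ 0 , + 0) ((+ 0 , + 0) ∷ []) []

Γ : ℕ → Drawing
Γ zero = single
Γ (suc zero) = single
Γ (suc (suc n)) = construction1 (Γ (suc n)) (Γ (suc n)) (Γ (suc n))

-- Construction 1 reads its three drawings only through their roots and bounding boxes:
-- translations shift a box, quarter turns permute its sides up to sign, and the box of
-- the new drawing is the hull of the new root and the boxes of the three parts.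
-- With its root at the origin, Γ (1 + n) spans [-(a+b), a+b] × [-a, b] with a + b + 1 = 2^n;
-- one more application of Construction 1 turns (a , b) into (a + b + 1 , a + b), which
-- doubles a + b + 1.  So the width is 2(a + b) + 1 = 2^(n+1) - 1 and the height a + b + 1.

module Submission where

open import Defs
open import Data.Nat using (ℕ; _≤_; _^_; _∸_)
open import Data.Integer using (+_)
open import Relation.Binary.PropositionalEquality using (_≡_)
open import Data.Product using (_×_)

open import Data.Integer using (ℤ; -_; _-_; _⊓_; _⊔_; +≤+) renaming (_+_ to _+ℤ_)
import Data.Integer.Properties as ℤ
open import Algebra.Definitions {A = ℤ} _≡_ using (Commutative; Associative; Idempotent)
open import Data.Integer.Tactic.RingSolver using (solve)
import Data.Nat as ℕ
open import Data.Nat using (z≤n)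
open import Data.Nat.Properties using (+-comm; m+n∸n≡m; m≤m+n; ≤-trans)
open import Data.Nat.Tactic.RingSolver using (solve-∀)
open import Data.List using ([]; _∷_; _++_; map; foldr)
open import Data.List.Properties using (map-++; map-∘; map-cong; foldr-++; foldr-map; foldr-fusion)
open import Data.Product using (∃; ∃₂; _,_; proj₁; proj₂)
open import Function using (id)
open import Relation.Binary.PropositionalEquality using (refl; sym; trans; cong; cong₂; module ≡-Reasoning)

extreme : (ℤ → ℤ → ℤ) → (Point → ℤ) → Drawing → ℤ
extreme op pr D = foldr op (pr (root D)) (map pr (nodes D))

-- An extreme is a fold started at the root; listing the root first among the nodes
-- makes that starting value redundant.
Rooted : Drawing → Set
Rooted D = ∃ λ ns → nodes D ≡ root D ∷ ns

mapD-rooted : ∀ f D → Rooted D → Rooted (mapD f D)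
mapD-rooted f _ (ns , eq) = map f ns , cong (map f) eq

Γ-rooted : ∀ n → Rooted (Γ n)
Γ-rooted 0 = _ , refl
Γ-rooted 1 = _ , refl
Γ-rooted (ℕ.suc (ℕ.suc n)) = _ , refl

extreme-mapD : (op op′ : ℤ → ℤ → ℤ) (pr pr′ : Point → ℤ) (f : Point → Point) (g : ℤ → ℤ) →
               (∀ p → pr′ (f p) ≡ g (pr p)) → (∀ x y → g (op x y) ≡ op′ (g x) (g y)) →
               ∀ D → extreme op′ pr′ (mapD f D) ≡ g (extreme op pr D)
extreme-mapD op op′ pr pr′ f g pr-f g-hom (drawing r ns _) = begin
  foldr op′ (pr′ (f r)) (map pr′ (map f ns))
    ≡⟨ cong₂ (foldr op′) (pr-f r) (trans (sym (map-∘ ns)) (trans (map-cong pr-f ns) (map-∘ ns))) ⟩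
  foldr op′ (g (pr r)) (map g (map pr ns))
    ≡⟨ foldr-map op′ g (g (pr r)) (map pr ns) ⟩
  foldr (λ x y → op′ (g x) y) (g (pr r)) (map pr ns)
    ≡⟨ sym (foldr-fusion g (pr r) g-hom (map pr ns)) ⟩
  g (foldr op (pr r) (map pr ns)) ∎
  where open ≡-Reasoning

module SemilatticeFold (op : ℤ → ℤ → ℤ) (comm : Commutative op) (assoc : Associative op) (idem : Idempotent op) where

  foldr-start : ∀ p q xs → foldr op (op p q) xs ≡ op p (foldr op q xs)
  foldr-start p q xs = sym (foldr-fusion (op p) q swap xs)
    where
    swap : ∀ x y → op p (op x y) ≡ op x (op p y)
    swap x y = trans (sym (assoc p x y)) (trans (cong (λ t → op t y) (comm p x)) (assoc x p y))

  foldr-absorbs-start : ∀ z xs → op z (foldr op z xs) ≡ foldr op z xs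
  foldr-absorbs-start z xs = trans (sym (foldr-start z z xs)) (cong (λ t → foldr op t xs) (idem z))

  module _ (pr : Point → ℤ) where

    foldr-nodes : ∀ D → Rooted D → ∀ w → foldr op w (map pr (nodes D)) ≡ op (extreme op pr D) w
    foldr-nodes (drawing r _ _) (ns , refl) w = begin
      op (pr r) (F w)          ≡⟨ sym (foldr-start (pr r) w xs) ⟩
      F (op (pr r) w)          ≡⟨ cong F (comm (pr r) w) ⟩
      F (op w (pr r))          ≡⟨ foldr-start w (pr r) xs ⟩
      op w (F (pr r))          ≡⟨ comm w _ ⟩
      op (F (pr r)) w          ≡⟨ cong (λ t → op (F t) w) (sym (idem (pr r))) ⟩
      op (F (op (pr r) (pr r))) w ≡⟨ cong (λ t → op t w) (foldr-start (pr r) (pr r) xs) ⟩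
      op (op (pr r) (F (pr r))) w ∎
      where
      open ≡-Reasoning
      xs = map pr ns
      F = λ z → foldr op z xs

    foldr-nodes-++ : ∀ D → Rooted D → ∀ w ys →
                     foldr op w (map pr (nodes D ++ ys)) ≡ op (extreme op pr D) (foldr op w (map pr ys))
    foldr-nodes-++ D rooted w ys = begin
      foldr op w (map pr (nodes D ++ ys))                   ≡⟨ cong (foldr op w) (map-++ pr (nodes D) ys) ⟩
      foldr op w (map pr (nodes D) ++ map pr ys)           ≡⟨ foldr-++ op w (map pr (nodes D)) (map pr ys) ⟩
      foldr op (foldr op w (map pr ys)) (map pr (nodes D)) ≡⟨ foldr-nodes D rooted _ ⟩
      op (extreme op pr D) (foldr op w (map pr ys))        ∎
      where open ≡-Reasoning

    extreme-join : ∀ r A B C es → Rooted A → Rooted B → Rooted C →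
                   extreme op pr (drawing r (r ∷ nodes A ++ nodes B ++ nodes C) es)
                   ≡ op (extreme op pr A) (op (extreme op pr B) (op (extreme op pr C) (pr r)))
    extreme-join r A B C _ rA rB rC = begin
      op (pr r) (foldr op (pr r) (map pr (nodes A ++ nodes B ++ nodes C)))
        ≡⟨ foldr-absorbs-start (pr r) (map pr (nodes A ++ nodes B ++ nodes C)) ⟩
      foldr op (pr r) (map pr (nodes A ++ nodes B ++ nodes C))
        ≡⟨ foldr-nodes-++ A rA (pr r) _ ⟩
      op (extreme op pr A) (foldr op (pr r) (map pr (nodes B ++ nodes C)))
        ≡⟨ cong (op (extreme op pr A)) (foldr-nodes-++ B rB (pr r) _) ⟩
      op (extreme op pr A) (op (extreme op pr B) (foldr op (pr r) (map pr (nodes C))))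
        ≡⟨ cong (λ t → op (extreme op pr A) (op (extreme op pr B) t)) (foldr-nodes C rC (pr r)) ⟩
      op (extreme op pr A) (op (extreme op pr B) (op (extreme op pr C) (pr r))) ∎
      where open ≡-Reasoning

open SemilatticeFold _⊓_ ℤ.⊓-comm ℤ.⊓-assoc ℤ.⊓-idem using () renaming (extreme-join to extreme-join-⊓)
open SemilatticeFold _⊔_ ℤ.⊔-comm ℤ.⊔-assoc ℤ.⊔-idem using () renaming (extreme-join to extreme-join-⊔)

record Box : Set where
  constructor bounds
  field
    left right bottom top : ℤ
open Box

cong-bounds : ∀ {l l′ r r′ b b′ t t′} → l ≡ l′ → r ≡ r′ → b ≡ b′ → t ≡ t′ → bounds l r b t ≡ bounds l′ r′ b′ t′
cong-bounds refl refl refl refl = refl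

infixr 5 _∪_
_∪_ : Box → Box → Box
β ∪ β′ = bounds (left β ⊓ left β′) (right β ⊔ right β′) (bottom β ⊓ bottom β′) (top β ⊔ top β′)

∪-cong₃ : ∀ {A A′ B B′ C C′} p → A ≡ A′ → B ≡ B′ → C ≡ C′ → A ∪ B ∪ C ∪ p ≡ A′ ∪ B′ ∪ C′ ∪ p
∪-cong₃ p refl refl refl = refl

pointBox : Point → Box
pointBox (x , y) = bounds x x y y

Frame : Set
Frame = Point × Box

bbox : Drawing → Box
bbox D = bounds (minX D) (maxX D) (minY D) (maxY D)

frame : Drawing → Frame
frame D = root D , bbox D

translateF : ℤ → ℤ → Frame → Frame
translateF dx dy (r , bounds l rt b t) = translateP dx dy r , bounds (l +ℤ dx) (rt +ℤ dx) (b +ℤ dy) (t +ℤ dy)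

rotCWF : Frame → Frame
rotCWF (r , bounds l rt b t) = rotCWP r , bounds b t (- rt) (- l)

rotCCWF : Frame → Frame
rotCCWF (r , bounds l rt b t) = rotCCWP r , bounds (- t) (- b) l rt

+-distrib-⊓ : ∀ d x y → (x ⊓ y) +ℤ d ≡ (x +ℤ d) ⊓ (y +ℤ d)
+-distrib-⊓ d = ℤ.mono-≤-distrib-⊓ (ℤ.+-monoˡ-≤ d)

+-distrib-⊔ : ∀ d x y → (x ⊔ y) +ℤ d ≡ (x +ℤ d) ⊔ (y +ℤ d)
+-distrib-⊔ d = ℤ.mono-≤-distrib-⊔ (ℤ.+-monoˡ-≤ d)

frame-translate : ∀ dx dy D → frame (translate dx dy D) ≡ translateF dx dy (frame D)
frame-translate dx dy D = cong₂ _,_ refl (cong-bounds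
  (extreme-mapD _⊓_ _⊓_ proj₁ proj₁ (translateP dx dy) (_+ℤ dx) (λ _ → refl) (+-distrib-⊓ dx) D)
  (extreme-mapD _⊔_ _⊔_ proj₁ proj₁ (translateP dx dy) (_+ℤ dx) (λ _ → refl) (+-distrib-⊔ dx) D)
  (extreme-mapD _⊓_ _⊓_ proj₂ proj₂ (translateP dx dy) (_+ℤ dy) (λ _ → refl) (+-distrib-⊓ dy) D)
  (extreme-mapD _⊔_ _⊔_ proj₂ proj₂ (translateP dx dy) (_+ℤ dy) (λ _ → refl) (+-distrib-⊔ dy) D))

frame-rotCW : ∀ D → frame (rotCW D) ≡ rotCWF (frame D)
frame-rotCW D = cong₂ _,_ refl (cong-bounds
  (extreme-mapD _⊓_ _⊓_ proj₂ proj₁ rotCWP id (λ _ → refl) (λ _ _ → refl) D)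
  (extreme-mapD _⊔_ _⊔_ proj₂ proj₁ rotCWP id (λ _ → refl) (λ _ _ → refl) D)
  (extreme-mapD _⊔_ _⊓_ proj₁ proj₂ rotCWP -_ (λ _ → refl) ℤ.neg-distrib-⊔-⊓ D)
  (extreme-mapD _⊓_ _⊔_ proj₁ proj₂ rotCWP -_ (λ _ → refl) ℤ.neg-distrib-⊓-⊔ D))

frame-rotCCW : ∀ D → frame (rotCCW D) ≡ rotCCWF (frame D)
frame-rotCCW D = cong₂ _,_ refl (cong-bounds
  (extreme-mapD _⊔_ _⊓_ proj₂ proj₁ rotCCWP -_ (λ _ → refl) ℤ.neg-distrib-⊔-⊓ D)
  (extreme-mapD _⊓_ _⊔_ proj₂ proj₁ rotCCWP -_ (λ _ → refl) ℤ.neg-distrib-⊓-⊔ D)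
  (extreme-mapD _⊓_ _⊓_ proj₁ proj₂ rotCCWP id (λ _ → refl) (λ _ _ → refl) D)
  (extreme-mapD _⊔_ _⊔_ proj₁ proj₂ rotCCWP id (λ _ → refl) (λ _ _ → refl) D))

bbox-join : ∀ r A B C es → Rooted A → Rooted B → Rooted C →
            bbox (drawing r (r ∷ nodes A ++ nodes B ++ nodes C) es) ≡ bbox A ∪ bbox B ∪ bbox C ∪ pointBox r
bbox-join r A B C es rA rB rC = cong-bounds
  (extreme-join-⊓ proj₁ r A B C es rA rB rC) (extreme-join-⊔ proj₁ r A B C es rA rB rC)
  (extreme-join-⊓ proj₂ r A B C es rA rB rC) (extreme-join-⊔ proj₂ r A B C es rA rB rC)

origin : Point
origin = + 0 , + 0

module Construction1F (φa φb φc : Frame) where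
  φA φB′ φB φC′ φC : Frame
  φA  = translateF (- proj₁ (proj₁ φa)) (- + 1 - top (proj₂ φa)) φa
  φB′ = rotCWF φb
  φB  = translateF ((left (proj₂ φA) - + 1) - right (proj₂ φB′)) (- proj₂ (proj₁ φB′)) φB′
  φC′ = rotCCWF φc
  φC  = translateF ((right (proj₂ φA) +ℤ + 1) - left (proj₂ φC′)) (- proj₂ (proj₁ φC′)) φC′

construction1F : Frame → Frame → Frame → Frame
construction1F φa φb φc = origin , proj₂ φA ∪ proj₂ φB ∪ proj₂ φC ∪ pointBox origin
  where open Construction1F φa φb φc

frame-construction1 : ∀ Γa Γb Γc → Rooted Γa → Rooted Γb → Rooted Γc →
                      frame (construction1 Γa Γb Γc) ≡ construction1F (frame Γa) (frame Γb) (frame Γc)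
frame-construction1 Γa Γb Γc ra rb rc = cong (origin ,_) (begin
  bbox (construction1 Γa Γb Γc)     ≡⟨ bbox-join origin A B C (edges (construction1 Γa Γb Γc)) rA rB rC ⟩
  bbox A ∪ bbox B ∪ bbox C ∪ pointBox origin
    ≡⟨ ∪-cong₃ (pointBox origin) (cong proj₂ frame-A) (cong proj₂ frame-B) (cong proj₂ frame-C) ⟩
  proj₂ φA ∪ proj₂ φB ∪ proj₂ φC ∪ pointBox origin ∎)
  where
  open ≡-Reasoning
  open Construction1F (frame Γa) (frame Γb) (frame Γc)
  A B′ B C′ C : Drawing
  A  = translate (- proj₁ (root Γa)) (- + 1 - maxY Γa) Γa
  B′ = rotCW Γb
  B  = translate ((minX A - + 1) - maxX B′) (- proj₂ (root B′)) B′
  C′ = rotCCW Γc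
  C  = translate ((maxX A +ℤ + 1) - minX C′) (- proj₂ (root C′)) C′
  rA : Rooted A
  rA = mapD-rooted _ Γa ra
  rB : Rooted B
  rB = mapD-rooted _ B′ (mapD-rooted _ Γb rb)
  rC : Rooted C
  rC = mapD-rooted _ C′ (mapD-rooted _ Γc rc)
  frame-A : frame A ≡ φA
  frame-A = frame-translate _ _ Γa
  frame-B : frame B ≡ φB
  frame-B = trans (frame-translate _ _ B′)
    (cong₂ (λ α β → translateF ((left (proj₂ α) - + 1) - right (proj₂ β)) (- proj₂ (proj₁ β)) β) frame-A (frame-rotCW Γb))
  frame-C : frame C ≡ φC
  frame-C = trans (frame-translate _ _ C′)
    (cong₂ (λ α γ → translateF ((right (proj₂ α) +ℤ + 1) - left (proj₂ γ)) (- proj₂ (proj₁ γ)) γ) frame-A (frame-rotCCW Γc))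

shape : ℤ → ℤ → Frame
shape α β = origin , bounds (- (α +ℤ β)) (α +ℤ β) (- α) β

module _ (α β : ℤ) where
  open Construction1F (shape α β) (shape α β) (shape α β)

  φA-shape : proj₂ φA ≡ bounds (- (α +ℤ β)) (α +ℤ β) (- (α +ℤ β +ℤ + 1)) (- + 1)
  φA-shape = begin
    proj₂ φA
      ≡⟨⟩
    bounds (- (α +ℤ β) +ℤ + 0) (α +ℤ β +ℤ + 0) (- α +ℤ (- + 1 - β)) (β +ℤ (- + 1 - β))
      ≡⟨ cong-bounds (solve (α ∷ β ∷ [])) (solve (α ∷ β ∷ [])) (solve (α ∷ β ∷ [])) (solve (α ∷ β ∷ [])) ⟩
    bounds (- (α +ℤ β)) (α +ℤ β) (- (α +ℤ β +ℤ + 1)) (- + 1) ∎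
    where open ≡-Reasoning

  φB-shape : proj₂ φB ≡ bounds (- (α +ℤ β +ℤ + 1 +ℤ (α +ℤ β))) (- (α +ℤ β +ℤ + 1)) (- (α +ℤ β)) (α +ℤ β)
  φB-shape = begin
    proj₂ φB
      ≡⟨⟩
    bounds (- α +ℤ (((- (α +ℤ β) +ℤ + 0) - + 1) - β)) (β +ℤ (((- (α +ℤ β) +ℤ + 0) - + 1) - β))
           (- (α +ℤ β) +ℤ + 0) (- (- (α +ℤ β)) +ℤ + 0)
      ≡⟨ cong-bounds (solve (α ∷ β ∷ [])) (solve (α ∷ β ∷ [])) (solve (α ∷ β ∷ [])) (solve (α ∷ β ∷ [])) ⟩
    bounds (- (α +ℤ β +ℤ + 1 +ℤ (α +ℤ β))) (- (α +ℤ β +ℤ + 1)) (- (α +ℤ β)) (α +ℤ β) ∎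
    where open ≡-Reasoning

  φC-shape : proj₂ φC ≡ bounds (α +ℤ β +ℤ + 1) (α +ℤ β +ℤ + 1 +ℤ (α +ℤ β)) (- (α +ℤ β)) (α +ℤ β)
  φC-shape = begin
    proj₂ φC
      ≡⟨⟩
    bounds (- β +ℤ (((α +ℤ β +ℤ + 0) +ℤ + 1) - - β)) (- - α +ℤ (((α +ℤ β +ℤ + 0) +ℤ + 1) - - β))
           (- (α +ℤ β) +ℤ + 0) (α +ℤ β +ℤ + 0)
      ≡⟨ cong-bounds (solve (α ∷ β ∷ [])) (solve (α ∷ β ∷ [])) (solve (α ∷ β ∷ [])) (solve (α ∷ β ∷ [])) ⟩
    bounds (α +ℤ β +ℤ + 1) (α +ℤ β +ℤ + 1 +ℤ (α +ℤ β)) (- (α +ℤ β)) (α +ℤ β) ∎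
    where open ≡-Reasoning

hull-shape : ∀ s → let t = s ℕ.+ 1 ℕ.+ s in
             bounds (- + s) (+ s) (- + (s ℕ.+ 1)) (- + 1) ∪ bounds (- + t) (- + (s ℕ.+ 1)) (- + s) (+ s)
             ∪ bounds (+ (s ℕ.+ 1)) (+ t) (- + s) (+ s) ∪ pointBox origin
             ≡ bounds (- + t) (+ t) (- + (s ℕ.+ 1)) (+ s)
hull-shape s = cong-bounds left-hull right-hull bottom-hull top-hull
  where
  open ≡-Reasoning
  t = s ℕ.+ 1 ℕ.+ s
  s≤s+1 : s ≤ s ℕ.+ 1
  s≤s+1 = m≤m+n s 1
  s≤t : s ≤ t
  s≤t = ≤-trans s≤s+1 (m≤m+n (s ℕ.+ 1) s)

  left-hull : - + s ⊓ (- + t ⊓ (+ (s ℕ.+ 1) ⊓ + 0)) ≡ - + t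
  left-hull = begin
    - + s ⊓ (- + t ⊓ (+ (s ℕ.+ 1) ⊓ + 0)) ≡⟨ cong (λ x → - + s ⊓ (- + t ⊓ x)) (ℤ.i≥j⇒i⊓j≡j (+≤+ (z≤n {s ℕ.+ 1}))) ⟩
    - + s ⊓ (- + t ⊓ + 0)                 ≡⟨ cong (- + s ⊓_) (ℤ.i≤j⇒i⊓j≡i (ℤ.neg-≤-pos {t} {0})) ⟩
    - + s ⊓ - + t                         ≡⟨ ℤ.i≥j⇒i⊓j≡j (ℤ.neg-mono-≤ (+≤+ s≤t)) ⟩
    - + t                                 ∎

  right-hull : + s ⊔ (- + (s ℕ.+ 1) ⊔ (+ t ⊔ + 0)) ≡ + t
  right-hull = begin
    + s ⊔ (- + (s ℕ.+ 1) ⊔ (+ t ⊔ + 0)) ≡⟨ cong (λ x → + s ⊔ (- + (s ℕ.+ 1) ⊔ x)) (ℤ.i≥j⇒i⊔j≡i (+≤+ (z≤n {t}))) ⟩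
    + s ⊔ (- + (s ℕ.+ 1) ⊔ + t)         ≡⟨ cong (+ s ⊔_) (ℤ.i≤j⇒i⊔j≡j (ℤ.neg-≤-pos {s ℕ.+ 1} {t})) ⟩
    + s ⊔ + t                           ≡⟨ ℤ.i≤j⇒i⊔j≡j (+≤+ s≤t) ⟩
    + t                                 ∎

  bottom-hull : - + (s ℕ.+ 1) ⊓ (- + s ⊓ (- + s ⊓ + 0)) ≡ - + (s ℕ.+ 1)
  bottom-hull = begin
    - + (s ℕ.+ 1) ⊓ (- + s ⊓ (- + s ⊓ + 0)) ≡⟨ cong (λ x → - + (s ℕ.+ 1) ⊓ (- + s ⊓ x)) (ℤ.i≤j⇒i⊓j≡i (ℤ.neg-≤-pos {s} {0})) ⟩
    - + (s ℕ.+ 1) ⊓ (- + s ⊓ - + s)         ≡⟨ cong (- + (s ℕ.+ 1) ⊓_) (ℤ.⊓-idem (- + s)) ⟩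
    - + (s ℕ.+ 1) ⊓ - + s                   ≡⟨ ℤ.i≤j⇒i⊓j≡i (ℤ.neg-mono-≤ (+≤+ s≤s+1)) ⟩
    - + (s ℕ.+ 1)                           ∎

  top-hull : - + 1 ⊔ (+ s ⊔ (+ s ⊔ + 0)) ≡ + s
  top-hull = begin
    - + 1 ⊔ (+ s ⊔ (+ s ⊔ + 0)) ≡⟨ cong (λ x → - + 1 ⊔ (+ s ⊔ x)) (ℤ.i≥j⇒i⊔j≡i (+≤+ (z≤n {s}))) ⟩
    - + 1 ⊔ (+ s ⊔ + s)         ≡⟨ cong (- + 1 ⊔_) (ℤ.⊔-idem (+ s)) ⟩
    - + 1 ⊔ + s                 ≡⟨ ℤ.i≤j⇒i⊔j≡j (ℤ.neg-≤-pos {1} {s}) ⟩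
    + s                         ∎

construction1F-shape : ∀ a b → construction1F (shape (+ a) (+ b)) (shape (+ a) (+ b)) (shape (+ a) (+ b))
                               ≡ shape (+ (a ℕ.+ b ℕ.+ 1)) (+ (a ℕ.+ b))
construction1F-shape a b = cong₂ _,_ refl (trans
  (∪-cong₃ (pointBox origin) (φA-shape (+ a) (+ b)) (φB-shape (+ a) (+ b)) (φC-shape (+ a) (+ b)))
  (hull-shape (a ℕ.+ b)))

s+1+s+1≡2*[s+1] : ∀ s → s ℕ.+ 1 ℕ.+ s ℕ.+ 1 ≡ 2 ℕ.* (s ℕ.+ 1)
s+1+s+1≡2*[s+1] = solve-∀

2*[s+1]≡s+s+1+1 : ∀ s → 2 ℕ.* (s ℕ.+ 1) ≡ s ℕ.+ s ℕ.+ 1 ℕ.+ 1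
2*[s+1]≡s+s+1+1 = solve-∀

Γ-frame : ∀ n → ∃₂ λ a b → a ℕ.+ b ℕ.+ 1 ≡ 2 ^ n × frame (Γ (ℕ.suc n)) ≡ shape (+ a) (+ b)
Γ-frame ℕ.zero = 0 , 0 , refl , refl
Γ-frame (ℕ.suc n) with Γ-frame n
... | a , b , size , eq = a ℕ.+ b ℕ.+ 1 , a ℕ.+ b , trans (s+1+s+1≡2*[s+1] (a ℕ.+ b)) (cong (2 ℕ.*_) size) , (begin
  frame (Γ (ℕ.suc (ℕ.suc n)))                  ≡⟨ frame-construction1 G G G rooted rooted rooted ⟩
  construction1F (frame G) (frame G) (frame G) ≡⟨ cong (λ φ → construction1F φ φ φ) eq ⟩
  construction1F (shape (+ a) (+ b)) (shape (+ a) (+ b)) (shape (+ a) (+ b)) ≡⟨ construction1F-shape a b ⟩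
  shape (+ (a ℕ.+ b ℕ.+ 1)) (+ (a ℕ.+ b))       ∎)
  where
  open ≡-Reasoning
  G = Γ (ℕ.suc n)
  rooted = Γ-rooted (ℕ.suc n)

width-of-shape : ∀ D a b → frame D ≡ shape (+ a) (+ b) → width D ≡ + (a ℕ.+ b ℕ.+ (a ℕ.+ b) ℕ.+ 1)
width-of-shape _ a b eq = trans (cong (λ φ → right (proj₂ φ) - left (proj₂ φ) +ℤ + 1) eq)
                              (cong (λ x → + (a ℕ.+ b) +ℤ x +ℤ + 1) (ℤ.neg-involutive (+ (a ℕ.+ b))))

height-of-shape : ∀ D a b → frame D ≡ shape (+ a) (+ b) → height D ≡ + (b ℕ.+ a ℕ.+ 1)
height-of-shape _ a b eq = trans (cong (λ φ → top (proj₂ φ) - bottom (proj₂ φ) +ℤ + 1) eq)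
                               (cong (λ x → + b +ℤ x +ℤ + 1) (ℤ.neg-involutive (+ a)))

lemma1 : (h : ℕ) → 1 ≤ h → (width (Γ h) ≡ + (2 ^ h ∸ 1)) × (height (Γ h) ≡ + (2 ^ (h ∸ 1)))
lemma1 ℕ.zero ()
lemma1 (ℕ.suc n) _ with Γ-frame n
... | a , b , size , eq = trans (width-of-shape (Γ (ℕ.suc n)) a b eq) (cong +_ width≡) , trans (height-of-shape (Γ (ℕ.suc n)) a b eq) (cong +_ height≡)
  where
  s = a ℕ.+ b
  width≡ : s ℕ.+ s ℕ.+ 1 ≡ 2 ^ ℕ.suc n ∸ 1
  width≡ = sym (begin
    2 ℕ.* 2 ^ n ∸ 1           ≡⟨ cong (λ k → 2 ℕ.* k ∸ 1) (sym size) ⟩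
    2 ℕ.* (s ℕ.+ 1) ∸ 1       ≡⟨ cong (_∸ 1) (2*[s+1]≡s+s+1+1 s) ⟩
    s ℕ.+ s ℕ.+ 1 ℕ.+ 1 ∸ 1   ≡⟨ m+n∸n≡m (s ℕ.+ s ℕ.+ 1) 1 ⟩
    s ℕ.+ s ℕ.+ 1             ∎)
    where open ≡-Reasoning
  height≡ : b ℕ.+ a ℕ.+ 1 ≡ 2 ^ n
  height≡ = trans (cong (ℕ._+ 1) (+-comm b a)) size
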